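{- Let $G$ be a finite connected unweighted graph with shortest-path metric $d$, and let $\hat\delta$ be its four-points hyperbolicity constant. Then there exist four vertices $u_1,u_2,u_3,u_4$ such that $$d(u_1,u_3)+d(u_2,u_4)=\max\{d(u_1,u_2)+d(u_3,u_4),\ d(u_1,u_4)+d(u_2,u_3)\}+2\hat\delta,$$ and for every $i\in\{1,2,3,4\}$ and every neighbor $w$ of $u_i$ we have $d(w,u_{i+2})\le d(u_i,u_{i+2})$, where indices are taken modulo $4$.
   Context: The four-points hyperbolicity constant of $G$ is the least $\hat\delta\ge0$ such that for all vertices $a,b,c,d$: $d(a,b)+d(c,d)\le\max\{d(a,c)+d(b,d),\ d(a,d)+d(b,c)\}+2\hat\delta$; equivalently $2\hat\delta$ is the maximum over quadruples of the difference between the largest and the second largest of the three sums $d(a,b)+d(c,d)$, $d(a,c)+d(b,d)$, $d(a,d)+d(b,c)$. -}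

module Defs where

open import Data.Nat using (ℕ; zero; suc; _+_; _≤_; _⊔_)
open import Data.Fin using (Fin; zero; suc)
open import Data.Product using (Σ; _×_; _,_; ∃)
open import Relation.Nullary using (¬_)
open import Relation.Binary.PropositionalEquality using (_≡_)

record Graph (n : ℕ) : Set₁ where
  field
    Adj      : Fin n → Fin n → Set
    symmetric : ∀ {u v} → Adj u v → Adj v u
    irreflexive : ∀ {u} → ¬ Adj u u

data Walk {n : ℕ} (G : Graph n) : Fin n → Fin n → ℕ → Set where
  here  : ∀ {u} → Walk G u u 0
  step  : ∀ {u v w k} → Graph.Adj G u v → Walk G v w k → Walk G u w (suc k)

Connected : {n : ℕ} → Graph n → Set
Connected {n} G = Fin n × (∀ u v → ∃ λ k → Walk G u v k)

IsShortestPathMetric : {n : ℕ} → Graph n → (Fin n → Fin n → ℕ) → Set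
IsShortestPathMetric {n} G d =
  ∀ u v → Walk G u v (d u v) × (∀ k → Walk G u v k → d u v ≤ k)

-- Four-point condition with constant D = 2δ (stated for the doubled constant, in ℕ).
FourPointBound : {n : ℕ} → (Fin n → Fin n → ℕ) → ℕ → Set
FourPointBound d D =
  ∀ a b c e → d a b + d c e ≤ ((d a c + d b e) ⊔ (d a e + d b c)) + D

IsTwiceHyperbolicity : {n : ℕ} → (Fin n → Fin n → ℕ) → ℕ → Set
IsTwiceHyperbolicity d D = FourPointBound d D × (∀ D' → FourPointBound d D' → D ≤ D')

opp : Fin 4 → Fin 4
opp zero = suc (suc zero)
opp (suc zero) = suc (suc (suc zero))
opp (suc (suc zero)) = zero
opp (suc (suc (suc zero))) = suc zero

module Submission where

-- Write a quadruple as (a, b, c, e), read cyclically, with diagonal sum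
-- S = d(a,c) + d(b,e) and side maximum M = max(d(a,b) + d(c,e), d(a,e) + d(b,c)).
-- The four-point bound says S ≤ M + D; call the quadruple tight when S = M + D.
--
-- 1. A tight quadruple exists: if D = 0 any constant quadruple is tight, and if
--    D = D' + 1 the minimality of D yields a quadruple violating the bound for D',
--    which (after reordering) is tight for D.
-- 2. If some u_i of a tight quadruple has a neighbour w strictly farther from
--    u_{i+2}, replacing u_i by w raises S by exactly one and M by at most one
--    (w is within distance one of u_i); with the four-point bound the new
--    quadruple is again tight.
-- 3. S is bounded by twice the diameter, so after finitely many such steps the
--    tight quadruple has no outward neighbour, which is the theorem.
--
-- Only symmetry, the triangle inequality and "adjacent vertices are at
-- distance at most one" are used, so steps 1-3 are proved for any such metric
-- and the shortest-path metric is shown to be one.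

open import Defs
open import Data.Nat using (ℕ; zero; suc; _+_; _≤_; _⊔_; _≤?_)
open import Data.Nat.Properties
  using (≤-trans; ≤-antisym; ≰⇒>; 1+n≰n; +-suc; +-identityʳ;
         +-mono-≤; +-monoˡ-≤; +-monoʳ-≤; ⊔-mono-≤; ⊔-idem; m≤n+m; module ≤-Reasoning)
open import Data.Fin using (Fin; zero; suc)
open import Data.Fin.Properties using (all?; ¬∀⟶∃¬)
open import Data.List using (map; allFin)
open import Data.List.Extrema.Nat using (max; xs≤max)
open import Data.List.Membership.Propositional.Properties using (∈-map⁺; ∈-allFin)
import Data.List.Relation.Unary.All as All
open import Data.Product using (Σ; _×_; _,_; proj₁; proj₂; ∃₂)
open import Data.Sum using (_⊎_; inj₁; inj₂)
open import Data.Empty using (⊥-elim)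
open import Relation.Nullary using (¬_; Dec; yes; no)
open import Relation.Nullary.Decidable using (_→-dec_)
open import Relation.Binary.PropositionalEquality
  using (_≡_; refl; sym; trans; cong; cong₂; subst; subst₂; module ≡-Reasoning)

_++ʷ_ : ∀ {n} {G : Graph n} {u v w k m} → Walk G u v k → Walk G v w m → Walk G u w (k + m)
here     ++ʷ q = q
step a p ++ʷ q = step a (p ++ʷ q)

reverseʷ : ∀ {n} {G : Graph n} {u v k} → Walk G u v k → Walk G v u k
reverseʷ {G = G} {k = k} p = subst (Walk G _ _) (+-identityʳ k) (go p here)
  where
    go : ∀ {u v x k m} → Walk G u v k → Walk G u x m → Walk G v x (k + m)
    go here                 q = q
    go {m = m} (step {k = k} a p) q =
      subst (Walk G _ _) (+-suc k m) (go p (step (Graph.symmetric G a) q))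

maxOver : ∀ {n} → (Fin n → ℕ) → ℕ
maxOver {n} f = max 0 (map f (allFin n))

≤maxOver : ∀ {n} (f : Fin n → ℕ) i → f i ≤ maxOver f
≤maxOver {n} f i = All.lookup (xs≤max 0 (map f (allFin n))) (∈-map⁺ f (∈-allFin i))

¬∀⟶∃¬₂ : ∀ {m n} (P : Fin m → Fin n → Set) → (∀ a b → Dec (P a b)) →
         ¬ (∀ a b → P a b) → ∃₂ λ a b → ¬ P a b
¬∀⟶∃¬₂ {m} {n} P P? ¬∀P with ¬∀⟶∃¬ m _ (λ a → all? (P? a)) ¬∀P
... | a , ¬∀Pa with ¬∀⟶∃¬ n _ (P? a) ¬∀Pa
...   | b , ¬Pab = a , b , ¬Pab

tight-step : ∀ {S M S' M' D} → S ≡ M + D → S' ≡ suc S → M' ≤ suc M → S' ≤ M' + D →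
             S' ≡ M' + D
tight-step {S} {M} {S'} {M'} {D} tight grows M'≤ bound = ≤-antisym bound (begin
  M' + D       ≤⟨ +-monoˡ-≤ D M'≤ ⟩
  suc (M + D)  ≡⟨ cong suc (sym tight) ⟩
  suc S        ≡⟨ sym grows ⟩
  S'           ∎)
  where open ≤-Reasoning

grow-left : ∀ {x x'} y → x' ≤ suc x → x' + y ≤ suc (x + y)
grow-left y h = +-monoˡ-≤ y h

grow-right : ∀ x {y y'} → y' ≤ suc y → x + y' ≤ suc (x + y)
grow-right x {y} {y'} h = subst (x + y' ≤_) (+-suc x y) (+-monoʳ-≤ x h)

record GraphMetric {n : ℕ} (G : Graph n) (d : Fin n → Fin n → ℕ) : Set where
  field
    symmetric  : ∀ u v → d u v ≡ d v u
    triangle   : ∀ u m v → d u v ≤ d u m + d m v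
    adjacent≤1 : ∀ {u v} → Graph.Adj G u v → d u v ≤ 1

shortestPath-graphMetric : ∀ {n} {G : Graph n} {d} → IsShortestPathMetric G d → GraphMetric G d
shortestPath-graphMetric {G = G} {d} sp = record
  { symmetric  = λ u v → ≤-antisym (minimal (reverseʷ (path v u))) (minimal (reverseʷ (path u v)))
  ; triangle   = λ u m v → minimal (path u m ++ʷ path m v)
  ; adjacent≤1 = λ a → minimal (step a here)
  }
  where
    path : ∀ u v → Walk G u v (d u v)
    path u v = proj₁ (sp u v)
    minimal : ∀ {u v k} → Walk G u v k → d u v ≤ k
    minimal w = proj₂ (sp _ _) _ w

quad : ∀ {n} → Fin n → Fin n → Fin n → Fin n → Fin 4 → Fin n
quad a b c e zero                   = a
quad a b c e (suc zero)             = b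
quad a b c e (suc (suc zero))       = c
quad a b c e (suc (suc (suc zero))) = e

module Extremal {n : ℕ} (G : Graph n) (d : Fin n → Fin n → ℕ) (metric : GraphMetric G d)
                (D : ℕ) (fourPointBound : FourPointBound d D) where
  open GraphMetric metric

  near-left : ∀ v w y → d v w ≤ 1 → d w y ≤ suc (d v y)
  near-left v w y h = ≤-trans (triangle w v y) (+-monoˡ-≤ (d v y) (subst (_≤ 1) (symmetric v w) h))

  near-right : ∀ v w y → d v w ≤ 1 → d y w ≤ suc (d y v)
  near-right v w y h = subst₂ _≤_ (symmetric w y) (cong suc (symmetric v y)) (near-left v w y h)

  farther : ∀ v w x → d v w ≤ 1 → ¬ (d w x ≤ d v x) → d w x ≡ suc (d v x)
  farther v w x near ¬closer = ≤-antisym (near-left v w x near) (≰⇒> ¬closer)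

  farther-right : ∀ v w x → d v w ≤ 1 → ¬ (d w x ≤ d v x) → d x w ≡ suc (d x v)
  farther-right v w x near ¬closer =
    trans (symmetric x w) (trans (farther v w x near ¬closer) (cong suc (symmetric v x)))

  S M : Fin n → Fin n → Fin n → Fin n → ℕ
  S a b c e = d a c + d b e
  M a b c e = (d a b + d c e) ⊔ (d a e + d b c)

  Tight : Fin n → Fin n → Fin n → Fin n → Set
  Tight a b c e = S a b c e ≡ M a b c e + D

  -- The four-point bound in the diagonal/side form; it is the statement of
  -- FourPointBound for the quadruple (a, c, b, e) up to the symmetry of d.
  M-reorder : ∀ a b c e → (d a c + d b e) ⊔ (d a e + d b c) ≡ M a c b e
  M-reorder a b c e = cong (λ z → (d a c + d b e) ⊔ (d a e + z)) (symmetric b c)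

  fourPoint : ∀ a b c e → S a b c e ≤ M a b c e + D
  fourPoint a b c e = subst (λ z → S a b c e ≤ z + D) (M-reorder a c b e) (fourPointBound a c b e)

  constant-tight : D ≡ 0 → ∀ v → Tight v v v v
  constant-tight D≡0 v = begin
    d v v + d v v  ≡⟨ sym (⊔-idem (d v v + d v v)) ⟩
    M v v v v      ≡⟨ sym (+-identityʳ _) ⟩
    M v v v v + 0  ≡⟨ cong (M v v v v +_) (sym D≡0) ⟩
    M v v v v + D  ∎
    where open ≡-Reasoning

  -- For D = D' + 1, a quadruple violating the bound for D' is tight after
  -- exchanging its second and third vertex.
  violation-tight : ∀ {D'} → D ≡ suc D' → ¬ FourPointBound d D' → ∃₂ λ a b → ∃₂ λ c e → Tight a b c e
  violation-tight {D'} D≡1+D' ¬bound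
    with ¬∀⟶∃¬₂ (λ a b → ∀ c e → _) (λ a b → all? (λ c → all? (λ e → _ ≤? _))) ¬bound
  ... | a , b , ¬∀ with ¬∀⟶∃¬₂ (λ c e → _) (λ c e → _ ≤? _) ¬∀
  ...   | c , e , violation = a , c , b , e , ≤-antisym (fourPoint a c b e) (begin
    M a c b e + D                                  ≡⟨ cong₂ _+_ (sym (M-reorder a b c e)) D≡1+D' ⟩
    ((d a c + d b e) ⊔ (d a e + d b c)) + suc D'   ≡⟨ +-suc _ D' ⟩
    suc (((d a c + d b e) ⊔ (d a e + d b c)) + D') ≤⟨ ≰⇒> violation ⟩
    d a b + d c e                                  ∎)
    where open ≤-Reasoning

  tight-exists : Fin n → (∀ D' → FourPointBound d D' → D ≤ D') → ∃₂ λ a b → ∃₂ λ c e → Tight a b c e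
  tight-exists v minimal = by-cases D refl
    where
      by-cases : ∀ D' → D ≡ D' → ∃₂ λ a b → ∃₂ λ c e → Tight a b c e
      by-cases zero    D≡0    = v , v , v , v , constant-tight D≡0 v
      by-cases (suc D') D≡1+D' =
        violation-tight D≡1+D' λ bound → 1+n≰n (subst (_≤ D') D≡1+D' (minimal D' bound))

  record Ascent (a b c e : Fin n) : Set where
    constructor ascent
    field
      a' b' c' e' : Fin n
      tight       : Tight a' b' c' e'
      grows       : S a' b' c' e' ≡ suc (S a b c e)

  ascent-from : ∀ {a b c e} a' b' c' e' → Tight a b c e →
                S a' b' c' e' ≡ suc (S a b c e) → M a' b' c' e' ≤ suc (M a b c e) → Ascent a b c e
  ascent-from a' b' c' e' tight grows M'≤ =
    ascent a' b' c' e' (tight-step tight grows M'≤ (fourPoint a' b' c' e')) grows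

  push : ∀ a b c e i w → Tight a b c e →
         d (quad a b c e i) w ≤ 1 → ¬ (d w (quad a b c e (opp i)) ≤ d (quad a b c e i) (quad a b c e (opp i))) →
         Ascent a b c e
  push a b c e zero w tight near ¬closer = ascent-from w b c e tight
    (cong (_+ d b e) (farther a w c near ¬closer))
    (⊔-mono-≤ (grow-left (d c e) (near-left a w b near)) (grow-left (d b c) (near-left a w e near)))
  push a b c e (suc zero) w tight near ¬closer = ascent-from a w c e tight
    (trans (cong (d a c +_) (farther b w e near ¬closer)) (+-suc (d a c) (d b e)))
    (⊔-mono-≤ (grow-left (d c e) (near-right b w a near)) (grow-right (d a e) (near-left b w c near)))
  push a b c e (suc (suc zero)) w tight near ¬closer = ascent-from a b w e tight
    (cong (_+ d b e) (farther-right c w a near ¬closer))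
    (⊔-mono-≤ (grow-right (d a b) (near-left c w e near)) (grow-right (d a e) (near-right c w b near)))
  push a b c e (suc (suc (suc zero))) w tight near ¬closer = ascent-from a b c w tight
    (trans (cong (d a c +_) (farther-right e w b near ¬closer)) (+-suc (d a c) (d b e)))
    (⊔-mono-≤ (grow-right (d a b) (near-right e w c near)) (grow-left (d b c) (near-right e w a near)))

  -- The conclusion's second property: no vertex has a neighbour farther from
  -- the opposite vertex.  Adjacency need not be decidable, so it is checked on
  -- all vertices within distance one.
  Outward : (Fin 4 → Fin n) → Set
  Outward u = ∀ i w → Graph.Adj G (u i) w → d w (u (opp i)) ≤ d (u i) (u (opp i))

  OutwardAt : (Fin 4 → Fin n) → Fin 4 → Fin n → Set
  OutwardAt u i w = d (u i) w ≤ 1 → d w (u (opp i)) ≤ d (u i) (u (opp i))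

  OutwardAt? : ∀ u i w → Dec (OutwardAt u i w)
  OutwardAt? u i w = (d (u i) w ≤? 1) →-dec (d w (u (opp i)) ≤? d (u i) (u (opp i)))

  outward-or-ascent : ∀ a b c e → Tight a b c e → Outward (quad a b c e) ⊎ Ascent a b c e
  outward-or-ascent a b c e tight with all? (λ i → all? (λ w → OutwardAt? (quad a b c e) i w))
  ... | yes outward = inj₁ λ i w adj → outward i w (adjacent≤1 adj)
  ... | no ¬outward with ¬∀⟶∃¬₂ (OutwardAt (quad a b c e)) (OutwardAt? (quad a b c e)) ¬outward
  ...   | i , w , ¬at with d (quad a b c e i) w ≤? 1
  ...     | no far   = ⊥-elim (¬at λ near → ⊥-elim (far near))
  ...     | yes near = inj₂ (push a b c e i w tight near λ closer → ¬at λ _ → closer)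

  diameter : ℕ
  diameter = maxOver λ a → maxOver (d a)

  S≤2diameter : ∀ a b c e → S a b c e ≤ diameter + diameter
  S≤2diameter a b c e = +-mono-≤ (≤diameter a c) (≤diameter b e)
    where
      ≤diameter : ∀ x y → d x y ≤ diameter
      ≤diameter x y = ≤-trans (≤maxOver (d x) y) (≤maxOver (λ a → maxOver (d a)) x)

  Witness : Set
  Witness = Σ (Fin 4 → Fin n) λ u →
    Tight (u zero) (u (suc zero)) (u (suc (suc zero))) (u (suc (suc (suc zero)))) × Outward u

  -- Ascend from a tight quadruple while at most fuel further ascents fit below the bound.
  climb : ∀ fuel a b c e → Tight a b c e → diameter + diameter ≤ S a b c e + fuel → Witness
  climb fuel a b c e tight room with outward-or-ascent a b c e tight
  ... | inj₁ outward = quad a b c e , tight , outward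
  climb zero a b c e tight room | inj₂ (ascent a' b' c' e' _ grows) =
    ⊥-elim (1+n≰n (begin
      suc (S a b c e)       ≡⟨ sym grows ⟩
      S a' b' c' e'         ≤⟨ S≤2diameter a' b' c' e' ⟩
      diameter + diameter   ≤⟨ room ⟩
      S a b c e + 0         ≡⟨ +-identityʳ _ ⟩
      S a b c e             ∎))
    where open ≤-Reasoning
  climb (suc fuel) a b c e tight room | inj₂ (ascent a' b' c' e' tight' grows) =
    climb fuel a' b' c' e' tight'
      (subst (diameter + diameter ≤_) (trans (+-suc _ fuel) (cong (_+ fuel) (sym grows))) room)

  outward-tight-quadruple : Fin n → (∀ D' → FourPointBound d D' → D ≤ D') → Witness
  outward-tight-quadruple v minimal with tight-exists v minimal
  ... | a , b , c , e , tight =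
    climb (diameter + diameter) a b c e tight (m≤n+m (diameter + diameter) (S a b c e))

mainTheorem6 : (n : ℕ) (G : Graph n) → Connected G →
    (d : Fin n → Fin n → ℕ) → IsShortestPathMetric G d →
    (D : ℕ) → IsTwiceHyperbolicity d D →
    Σ (Fin 4 → Fin n) λ u →
      (d (u zero) (u (suc (suc zero))) + d (u (suc zero)) (u (suc (suc (suc zero))))
        ≡ ((d (u zero) (u (suc zero)) + d (u (suc (suc zero))) (u (suc (suc (suc zero)))))
          ⊔ (d (u zero) (u (suc (suc (suc zero)))) + d (u (suc zero)) (u (suc (suc zero)))))
          + D)
      × (∀ i w → Graph.Adj G (u i) w → d w (u (opp i)) ≤ d (u i) (u (opp i)))
mainTheorem6 n G (v , _) d shortestPath D (bound , minimal) =
  Extremal.outward-tight-quadruple G d (shortestPath-graphMetric shortestPath) D bound v minimal
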